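{- Let $c=s_{a_1}\cdots s_{a_n}$ be a Coxeter element of $A_n$, let $H^\infty$ be the heap of the infinite word $c^\infty$, and let $H\subseteq H^\infty$ be the set of positions of $c^\infty$ used by the $c$-sorting word $\mathrm{sort}_c(w_0)$ (an order ideal of $H^\infty$). Let $I$ be an order ideal of $H$, and let $\mathbf{u}$ be the word obtained by listing the labels of the elements of $I$ in increasing order (equivalently, scanning $z=1,2,3,\dots$ and appending the label of $z$ and removing $z$ whenever $z$ is a minimal element of the remaining part of $I$, until nothing remains). Let $w$ be the permutation $s_{u_1}\cdots s_{u_m}$ where $\mathbf{u}=[u_1\cdots u_m]$. Then $\mathbf{u}$ is the $c$-sorting word of $w$.
   Context: $A_n$ is the symmetric group on $[n+1]$, $s_i$ exchanges $i,i+1$, permutations compose as functions; $w_0(i)=n+2-i$. A Coxeter element is $c=s_{a_1}\cdots s_{a_n}$ with $(a_1,\dots,a_n)$ a permutation of $[n]$. Set $a_{kn+i}=a_i$ for $k\ge0$, $1\le i\le n$, so $c^\infty=a_1a_2a_3\cdots$. $\mathrm{sort}_c(w)$ is the lexicographically first (as a sequence of positions in $c^\infty$) subword of $c^\infty$ that is a reduced word for $w$. $H^\infty$ is the poset on the positive integers generated by $x\prec y$ whenever $x<y$ and $|a_x-a_y|\le1$, element $x$ having label $a_x$; order ideals are downward-closed subsets. -}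

module Defs where

open import Data.Nat using (ℕ; zero; suc; _+_; _∸_; _≤_; _<_; _≟_)
open import Data.Nat.DivMod using (_%_; m%n<n)
open import Data.Fin using (Fin; fromℕ<)
open import Data.List using (List; []; _∷_; map; length)
open import Data.List.Relation.Unary.All using (All)
open import Data.List.Relation.Unary.Linked using (Linked)
open import Data.Product using (_×_)
open import Data.Sum using (_⊎_)
open import Relation.Binary.PropositionalEquality using (_≡_)
open import Relation.Nullary using (yes; no)
open import Function using (id; _∘_)

-- Throughout, the rank is n = suc k (so n ≥ 1), the group is the symmetric
-- group on [n+1] = {1,…,n+1}, and a Coxeter element c = s_{a_1}⋯s_{a_n} is
-- given by a : Fin n → ℕ (a zero = a_1, …), required (in the statement) to be
-- injective with values in [1,n].

-- Permutations of [n+1] as functions ℕ → ℕ (identity outside [1,n+1]).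

s : ℕ → ℕ → ℕ
s i j with j ≟ i
... | yes _ = suc i
... | no _ with j ≟ suc i
...   | yes _ = i
...   | no _ = j

wordPerm : List ℕ → ℕ → ℕ
wordPerm [] = id
wordPerm (u ∷ us) = s u ∘ wordPerm us

_≈[_]_ : (ℕ → ℕ) → ℕ → (ℕ → ℕ) → Set
f ≈[ n ] g = ∀ j → 1 ≤ j → j ≤ suc n → f j ≡ g j

w0 : ℕ → ℕ → ℕ
w0 n i = (n + 2) ∸ i

Letters : ℕ → List ℕ → Set
Letters n = All (λ i → 1 ≤ i × i ≤ n)

IsReducedWord : (n : ℕ) → (ℕ → ℕ) → List ℕ → Set
IsReducedWord n w u =
  Letters n u × wordPerm u ≈[ n ] w ×
  (∀ v → Letters n v → wordPerm v ≈[ n ] w → length u ≤ length v)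

-- The infinite word c^∞ : position x ≥ 1 carries label a_{((x-1) mod n)+1}.

lab : {k : ℕ} → (Fin (suc k) → ℕ) → ℕ → ℕ
lab {k} a x = a (fromℕ< (m%n<n (x ∸ 1) (suc k)))

-- a subword of c^∞, given by its strictly increasing list of positions (≥ 1)
IsPositions : List ℕ → Set
IsPositions ps = Linked _<_ ps × All (1 ≤_) ps

data LexLt : List ℕ → List ℕ → Set where
  nil  : ∀ {y ys} → LexLt [] (y ∷ ys)
  here : ∀ {x y xs ys} → x < y → LexLt (x ∷ xs) (y ∷ ys)
  there : ∀ {x xs ys} → LexLt xs ys → LexLt (x ∷ xs) (x ∷ ys)

LexLe : List ℕ → List ℕ → Set
LexLe ps qs = ps ≡ qs ⊎ LexLt ps qs

-- ps is (the position sequence of) sort_c(w): the lexicographically first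
-- subword of c^∞ that is a reduced word for w
IsSortPositions : {k : ℕ} → (Fin (suc k) → ℕ) → (ℕ → ℕ) → List ℕ → Set
IsSortPositions {k} a w ps =
  IsPositions ps × IsReducedWord (suc k) w (map (lab a) ps) ×
  (∀ qs → IsPositions qs → IsReducedWord (suc k) w (map (lab a) qs) → LexLe ps qs)

-- The heap H^∞: partial order on positions generated by x ≺ y when x < y
-- and |a_x - a_y| ≤ 1 (reflexive-transitive closure).

data HeapLe {k : ℕ} (a : Fin (suc k) → ℕ) : ℕ → ℕ → Set where
  hrefl : ∀ {x} → HeapLe a x x
  hstep : ∀ {x y z} → x < y → lab a x ≤ suc (lab a y) → lab a y ≤ suc (lab a x) →
          HeapLe a y z → HeapLe a x z

-- Since I is an order ideal of H, a letter of H outside I commutes with every later letter of I.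
-- Hence, for every threshold t, the positions of H above t give the same permutation as the
-- positions of I above t followed by those of H ∖ I above t.  Both are factors of the reduced
-- word H for w₀, so they are reduced; for t = 0 this says that I is reduced.
-- For lexicographic minimality, compare a competing word qs with I above t.  If qs starts at a
-- position y before the first position of I above t, then either y ∈ H, and the letter of y
-- followed by I above y is already reduced, so qs is too long; or y ∉ H, and replacing I above t
-- inside H by qs, with H ∖ I above t moved a whole number of periods of c^∞ to the right, gives
-- a reduced word for w₀ lexicographically smaller than H = sort_c(w₀).
module Submission where

open import Defs
open import Data.Nat using (ℕ; zero; suc; _+_; _*_; _≤_; _<_; _≟_; _≤?_; _<?_; z≤n; s≤s; s≤s⁻¹; NonZero)
open import Data.Nat.Properties
open import Data.Nat.DivMod using ([m+kn]%n≡m%n)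
open import Data.Fin using (Fin)
open import Data.Fin.Properties using (fromℕ<-cong)
open import Data.List using (List; []; _∷_; _++_; length; map; filter)
open import Data.List.Properties using (length-++; length-map; map-++; ∷-injectiveʳ; ++-cancelˡ; filter-accept; filter-reject; filter-all; filter-none)
open import Data.List.Extrema.Nat using (max; ⊥≤max; xs≤max)
open import Data.List.Membership.Propositional using (_∈_)
open import Data.List.Membership.Propositional.Properties using (∈-filter⁺; ∈-filter⁻)
open import Data.List.Membership.DecPropositional _≟_ using (_∈?_)
open import Data.List.Relation.Binary.Subset.Propositional using (_⊆_)
open import Data.List.Relation.Unary.All as All using (All; []; _∷_)
import Data.List.Relation.Unary.All.Properties as All
open import Data.List.Relation.Unary.AllPairs as AllPairs using (AllPairs; []; _∷_)
import Data.List.Relation.Unary.AllPairs.Properties as AllPairs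
open import Data.List.Relation.Unary.Any using (here; there)
open import Data.List.Relation.Unary.Linked using (Linked)
open import Data.List.Relation.Unary.Linked.Properties using (Linked⇒AllPairs; AllPairs⇒Linked)
open import Data.Product using (_×_; _,_; ∃; proj₁; proj₂)
open import Data.Sum using (_⊎_; inj₁; inj₂)
open import Data.Empty using (⊥; ⊥-elim)
open import Function using (_∘_)
open import Relation.Binary.Definitions using (tri<; tri≈; tri>)
open import Relation.Binary.PropositionalEquality using (_≡_; refl; sym; trans; cong; cong₂; subst; subst₂; _≗_; module ≡-Reasoning)
open import Relation.Nullary using (¬_; Dec; yes; no; contradiction)
open import Relation.Nullary.Decidable using (_⊎-dec_; _×-dec_)
open import Relation.Unary using (Decidable)
open import Relation.Unary.Properties using (∁?)

Moved : ℕ → ℕ → Set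
Moved i j = j ≡ i ⊎ j ≡ suc i

moved? : ∀ i j → Dec (Moved i j)
moved? i j = (j ≟ i) ⊎-dec (j ≟ suc i)

s-fixes : ∀ {i j} → ¬ Moved i j → s i j ≡ j
s-fixes {i} {j} ¬moved with j ≟ i
... | yes j≡i = contradiction (inj₁ j≡i) ¬moved
... | no _ with j ≟ suc i
...   | yes j≡1+i = contradiction (inj₂ j≡1+i) ¬moved
...   | no _ = refl

s-left : ∀ i → s i i ≡ suc i
s-left i with i ≟ i
... | yes _ = refl
... | no i≢i = contradiction refl i≢i

s-right : ∀ i → s i (suc i) ≡ i
s-right i with suc i ≟ i
... | yes 1+i≡i = contradiction 1+i≡i (1+n≢n)
... | no _ with suc i ≟ suc i
...   | yes _ = refl
...   | no 1+i≢1+i = contradiction refl 1+i≢1+i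

s-moves : ∀ {i j} → Moved i j → Moved i (s i j)
s-moves {i} (inj₁ refl) = inj₂ (s-left i)
s-moves {i} (inj₂ refl) = inj₁ (s-right i)

s-involutive : ∀ i j → s i (s i j) ≡ j
s-involutive i j with moved? i j
... | yes (inj₁ refl) = trans (cong (s i) (s-left i)) (s-right i)
... | yes (inj₂ refl) = trans (cong (s i) (s-right i)) (s-left i)
... | no ¬moved = trans (cong (s i) (s-fixes ¬moved)) (s-fixes ¬moved)

s-injective : ∀ i {j j′} → s i j ≡ s i j′ → j ≡ j′
s-injective i {j} {j′} eq = begin
  j             ≡⟨ s-involutive i j ⟨
  s i (s i j)   ≡⟨ cong (s i) eq ⟩
  s i (s i j′)  ≡⟨ s-involutive i j′ ⟩
  j′            ∎
  where open ≡-Reasoning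

Near : ℕ → ℕ → Set
Near l m = l ≤ suc m × m ≤ suc l

moved-near : ∀ {l m j} → Moved l j → Moved m j → Near l m
moved-near {l} (inj₁ refl) (inj₁ refl) = n≤1+n l , n≤1+n l
moved-near {l} (inj₁ refl) (inj₂ refl) = ≤-refl , m≤n+m _ 2
moved-near {m = m} (inj₂ refl) (inj₁ refl) = m≤n+m _ 2 , ≤-refl
moved-near {l} (inj₂ refl) (inj₂ refl) = n≤1+n l , n≤1+n l

s-comm : ∀ {l m} → ¬ Near l m → s l ∘ s m ≗ s m ∘ s l
s-comm {l} {m} far j with moved? l j | moved? m j
... | yes l-moves | yes m-moves = contradiction (moved-near l-moves m-moves) far
... | yes l-moves | no ¬m-moves = begin
  s l (s m j) ≡⟨ cong (s l) (s-fixes ¬m-moves) ⟩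
  s l j       ≡⟨ s-fixes (far ∘ moved-near (s-moves l-moves)) ⟨
  s m (s l j) ∎
  where open ≡-Reasoning
... | no ¬l-moves | yes m-moves = begin
  s l (s m j) ≡⟨ s-fixes (far ∘ λ l-moves′ → moved-near l-moves′ (s-moves m-moves)) ⟩
  s m j       ≡⟨ cong (s m) (s-fixes ¬l-moves) ⟨
  s m (s l j) ∎
  where open ≡-Reasoning
... | no ¬l-moves | no ¬m-moves = begin
  s l (s m j) ≡⟨ cong (s l) (s-fixes ¬m-moves) ⟩
  s l j       ≡⟨ s-fixes ¬l-moves ⟩
  j           ≡⟨ s-fixes ¬m-moves ⟨
  s m j       ≡⟨ cong (s m) (s-fixes ¬l-moves) ⟨
  s m (s l j) ∎
  where open ≡-Reasoning

wordPerm-++ : ∀ u v → wordPerm (u ++ v) ≗ wordPerm u ∘ wordPerm v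
wordPerm-++ []      v j = refl
wordPerm-++ (x ∷ u) v j = cong (s x) (wordPerm-++ u v j)

wordPerm-comm : ∀ {l} u → All (¬_ ∘ Near l) u → s l ∘ wordPerm u ≗ wordPerm u ∘ s l
wordPerm-comm []      []           j = refl
wordPerm-comm (x ∷ u) (far ∷ fars) j =
  trans (s-comm far (wordPerm u j)) (cong (s x) (wordPerm-comm u fars j))

InRange : ℕ → ℕ → Set
InRange n j = 1 ≤ j × j ≤ suc n

wordPerm-fixes : ∀ {n j} u → Letters n u → ¬ InRange n j → wordPerm u j ≡ j
wordPerm-fixes []      []                  out = refl
wordPerm-fixes (x ∷ u) ((1≤x , x≤n) ∷ lu) out =
  trans (cong (s x) (wordPerm-fixes u lu out)) (s-fixes (out ∘ inRange))
  where
  inRange : Moved x _ → InRange _ _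
  inRange (inj₁ refl) = 1≤x , m≤n⇒m≤1+n x≤n
  inRange (inj₂ refl) = s≤s z≤n , s≤s x≤n

≈⇒≗ : ∀ {n u v} → Letters n u → Letters n v → wordPerm u ≈[ n ] wordPerm v → wordPerm u ≗ wordPerm v
≈⇒≗ {n} {u} {v} lu lv u≈v j with (1 ≤? j) ×-dec (j ≤? suc n)
... | yes (1≤j , j≤1+n) = u≈v j 1≤j j≤1+n
... | no out = trans (wordPerm-fixes u lu out) (sym (wordPerm-fixes v lv out))

Shortest : ℕ → List ℕ → Set
Shortest n u = ∀ v → Letters n v → wordPerm v ≗ wordPerm u → length u ≤ length v

reduced⇒shortest : ∀ {n w u} → IsReducedWord n w u → Shortest n u
reduced⇒shortest (_ , u≈w , minimal) v lv v≗u = minimal v lv (λ j 1≤j j≤1+n → trans (v≗u j) (u≈w j 1≤j j≤1+n))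

shortest⇒reduced : ∀ {n u} → Letters n u → Shortest n u → IsReducedWord n (wordPerm u) u
shortest⇒reduced lu shortest = lu , (λ _ _ _ → refl) , λ v lv v≈u → shortest v lv (≈⇒≗ lv lu v≈u)

shortest-resp : ∀ {n u u′} → wordPerm u ≗ wordPerm u′ → length u ≡ length u′ →
                Shortest n u → Shortest n u′
shortest-resp u≗u′ |u|≡|u′| shortest v lv v≗u′ =
  subst (_≤ length v) |u|≡|u′| (shortest v lv (λ j → trans (v≗u′ j) (sym (u≗u′ j))))

shortest-++⁻ˡ : ∀ {n} ys {zs} → Letters n zs → Shortest n (ys ++ zs) → Shortest n ys
shortest-++⁻ˡ ys {zs} lzs shortest v lv v≗ys = +-cancelʳ-≤ (length zs) _ _ (begin
  length ys + length zs ≡⟨ length-++ ys ⟨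
  length (ys ++ zs)     ≤⟨ shortest (v ++ zs) (All.++⁺ lv lzs) v++zs≗ys++zs ⟩
  length (v ++ zs)      ≡⟨ length-++ v ⟩
  length v + length zs  ∎)
  where
  open ≤-Reasoning
  v++zs≗ys++zs : wordPerm (v ++ zs) ≗ wordPerm (ys ++ zs)
  v++zs≗ys++zs j = trans (wordPerm-++ v zs j) (trans (v≗ys (wordPerm zs j)) (sym (wordPerm-++ ys zs j)))

shortest-++⁻ʳ : ∀ {n ys} zs → Letters n ys → Shortest n (ys ++ zs) → Shortest n zs
shortest-++⁻ʳ {ys = ys} zs lys shortest v lv v≗zs = +-cancelˡ-≤ (length ys) _ _ (begin
  length ys + length zs ≡⟨ length-++ ys ⟨
  length (ys ++ zs)     ≤⟨ shortest (ys ++ v) (All.++⁺ lys lv) ys++v≗ys++zs ⟩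
  length (ys ++ v)      ≡⟨ length-++ ys ⟩
  length ys + length v  ∎)
  where
  open ≤-Reasoning
  ys++v≗ys++zs : wordPerm (ys ++ v) ≗ wordPerm (ys ++ zs)
  ys++v≗ys++zs j = trans (wordPerm-++ ys v j) (trans (cong (wordPerm ys) (v≗zs j)) (sym (wordPerm-++ ys zs j)))

LexLt-asym : ∀ {xs ys} → LexLt xs ys → ¬ LexLt ys xs
LexLt-asym nil        ()
LexLt-asym (here x<y) (here y<x) = <-asym x<y y<x
LexLt-asym (here x<x) (there _)  = <-irrefl refl x<x
LexLt-asym (there _)  (here x<x) = <-irrefl refl x<x
LexLt-asym (there lt) (there gt) = LexLt-asym lt gt

LexLe⇒≯ : ∀ {xs ys} → LexLe xs ys → ¬ LexLt ys xs
LexLe⇒≯ (inj₁ refl) lt = LexLt-asym lt lt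
LexLe⇒≯ (inj₂ lt)   gt = LexLt-asym lt gt

LexLe-∷ : ∀ {x xs ys} → LexLe xs ys → LexLe (x ∷ xs) (x ∷ ys)
LexLe-∷ (inj₁ refl) = inj₁ refl
LexLe-∷ (inj₂ lt)   = inj₂ (there lt)

LexLe-++⁻ : ∀ ps {xs ys} → LexLe (ps ++ xs) (ps ++ ys) → LexLe xs ys
LexLe-++⁻ []       le                = le
LexLe-++⁻ (p ∷ ps) (inj₁ eq)         = inj₁ (++-cancelˡ ps _ _ (∷-injectiveʳ eq))
LexLe-++⁻ (p ∷ ps) (inj₂ (here p<p)) = contradiction p<p (<-irrefl refl)
LexLe-++⁻ (p ∷ ps) (inj₂ (there lt)) = LexLe-++⁻ ps (inj₂ lt)

Increasing : List ℕ → Set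
Increasing = AllPairs _<_

⊆-tail : ∀ {x y xs ys} → x ≡ y → All (x <_) xs → x ∷ xs ⊆ y ∷ ys → xs ⊆ ys
⊆-tail refl x<xs sub z∈xs with sub (there z∈xs)
... | here refl  = contradiction (All.lookup x<xs z∈xs) (<-irrefl refl)
... | there z∈ys = z∈ys

increasing-⊆-antisym : ∀ {xs ys} → Increasing xs → Increasing ys → xs ⊆ ys → ys ⊆ xs → xs ≡ ys
increasing-⊆-antisym []              []              _   _   = refl
increasing-⊆-antisym []              (_ ∷ _)         _   sup with sup (here refl)
... | ()
increasing-⊆-antisym (_ ∷ _)         []              sub _   with sub (here refl)
... | ()
increasing-⊆-antisym (x<xs ∷ xs-inc) (y<ys ∷ ys-inc) sub sup =
  cong₂ _∷_ x≡y (increasing-⊆-antisym xs-inc ys-inc (⊆-tail x≡y x<xs sub) (⊆-tail (sym x≡y) y<ys sup))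
  where
  x≡y : _
  x≡y with sub (here refl) | sup (here refl)
  ... | here x≡y   | _          = x≡y
  ... | there _    | here y≡x   = sym y≡x
  ... | there x∈ys | there y∈xs = contradiction (All.lookup y<ys x∈ys) (<-asym (All.lookup x<xs y∈xs))

above : ℕ → List ℕ → List ℕ
above t = filter (t <?_)

above-increasing : ∀ t {xs} → Increasing xs → Increasing (above t xs)
above-increasing t = AllPairs.filter⁺ (t <?_)

atMost : ℕ → List ℕ → List ℕ
atMost t = filter (_≤? t)

atMost++above : ∀ t {xs} → Increasing xs → atMost t xs ++ above t xs ≡ xs
atMost++above t {[]}     []            = refl
atMost++above t {x ∷ xs} (x<xs ∷ inc) with x ≤? t
... | yes x≤t = begin
  atMost t (x ∷ xs) ++ above t (x ∷ xs) ≡⟨ cong₂ _++_ (filter-accept (_≤? t) x≤t) (filter-reject (t <?_) (≤⇒≯ x≤t)) ⟩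
  x ∷ atMost t xs ++ above t xs         ≡⟨ cong (x ∷_) (atMost++above t inc) ⟩
  x ∷ xs                                ∎
  where open ≡-Reasoning
... | no x≰t = begin
  atMost t (x ∷ xs) ++ above t (x ∷ xs) ≡⟨ cong₂ _++_ (filter-reject (_≤? t) x≰t) (filter-accept (t <?_) t<x) ⟩
  atMost t xs ++ x ∷ above t xs         ≡⟨ cong₂ (λ ys zs → ys ++ x ∷ zs) (filter-none (_≤? t) (All.map (<⇒≱ ∘ <-trans t<x) x<xs))
                                                                      (filter-all (t <?_) (All.map (<-trans t<x) x<xs)) ⟩
  x ∷ xs                                ∎
  where
  open ≡-Reasoning
  t<x = ≰⇒> x≰t

above-above : ∀ {t u} → t ≤ u → ∀ xs → above u (above t xs) ≡ above u xs
above-above t≤u []       = refl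
above-above {t} {u} t≤u (x ∷ xs) with t <? x
... | no t≮x = begin
  above u (above t (x ∷ xs)) ≡⟨ cong (above u) (filter-reject (t <?_) t≮x) ⟩
  above u (above t xs)       ≡⟨ above-above t≤u xs ⟩
  above u xs                 ≡⟨ filter-reject (u <?_) (t≮x ∘ ≤-<-trans t≤u) ⟨
  above u (x ∷ xs)           ∎
  where open ≡-Reasoning
... | yes t<x = trans (cong (above u) (filter-accept (t <?_) t<x)) (keep-x (u <? x))
  where
  keep-x : Dec (u < x) → above u (x ∷ above t xs) ≡ above u (x ∷ xs)
  keep-x (yes u<x) = trans (filter-accept (u <?_) u<x)
                       (trans (cong (x ∷_) (above-above t≤u xs)) (sym (filter-accept (u <?_) u<x)))
  keep-x (no u≮x)  = trans (filter-reject (u <?_) u≮x)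
                       (trans (above-above t≤u xs) (sym (filter-reject (u <?_) u≮x)))

above-suc : ∀ t {xs} → Increasing xs → suc t ∈ xs → above t xs ≡ suc t ∷ above (suc t) xs
above-suc t {_ ∷ xs} (t+1<xs ∷ _) (here refl) = begin
  above t (suc t ∷ xs)               ≡⟨ filter-accept (t <?_) (n<1+n t) ⟩
  suc t ∷ above t xs                 ≡⟨ cong (suc t ∷_) (filter-all (t <?_) (All.map (<-trans (n<1+n t)) t+1<xs)) ⟩
  suc t ∷ xs                         ≡⟨ cong (suc t ∷_) (filter-all (suc t <?_) t+1<xs) ⟨
  suc t ∷ above (suc t) xs           ≡⟨ cong (suc t ∷_) (filter-reject (suc t <?_) (<-irrefl refl)) ⟨
  suc t ∷ above (suc t) (suc t ∷ xs) ∎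
  where open ≡-Reasoning
above-suc t {x ∷ xs} (x<xs ∷ inc) (there t+1∈xs) = begin
  above t (x ∷ xs)                 ≡⟨ filter-reject (t <?_) (≤⇒≯ x≤t) ⟩
  above t xs                       ≡⟨ above-suc t inc t+1∈xs ⟩
  suc t ∷ above (suc t) xs         ≡⟨ cong (suc t ∷_) (filter-reject (suc t <?_) (≤⇒≯ (m≤n⇒m≤1+n x≤t))) ⟨
  suc t ∷ above (suc t) (x ∷ xs)   ∎
  where
  open ≡-Reasoning
  x≤t = s≤s⁻¹ (All.lookup x<xs t+1∈xs)

module _ {A : Set} {P : A → Set} (P? : Decidable P) where

  length-partition : ∀ xs → length (filter P? xs) + length (filter (∁? P?) xs) ≡ length xs
  length-partition []       = refl
  length-partition (x ∷ xs) with P? x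
  ... | yes _ = cong suc (length-partition xs)
  ... | no _  = trans (+-suc _ _) (cong suc (length-partition xs))

  wordPerm-partition : ∀ (f : A → ℕ) xs → AllPairs (λ x y → ¬ P x → P y → ¬ Near (f x) (f y)) xs →
    wordPerm (map f xs) ≗ wordPerm (map f (filter P? xs)) ∘ wordPerm (map f (filter (∁? P?) xs))
  wordPerm-partition f []       []                    j = refl
  wordPerm-partition f (x ∷ xs) (x-commutes ∷ pairs) j with P? x
  ... | yes _  = cong (s (f x)) (wordPerm-partition f xs pairs j)
  ... | no ¬px = begin
    s (f x) (wordPerm (map f xs) j)              ≡⟨ cong (s (f x)) (wordPerm-partition f xs pairs j) ⟩
    s (f x) (wordPerm Pword (wordPerm ∁Pword j)) ≡⟨ wordPerm-comm Pword far (wordPerm ∁Pword j) ⟩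
    wordPerm Pword (s (f x) (wordPerm ∁Pword j)) ∎
    where
    open ≡-Reasoning
    Pword = map f (filter P? xs)
    ∁Pword = map f (filter (∁? P?) xs)
    far : All (¬_ ∘ Near (f x)) Pword
    far = All.map⁺ (All.tabulate λ y∈ → let y∈xs , py = ∈-filter⁻ P? y∈ in All.lookup x-commutes y∈xs ¬px py)

shift : ℕ → ℕ → List ℕ → List ℕ
shift n m = map (_+ m * n)

shift-increasing : ∀ n m {xs} → Increasing xs → Increasing (shift n m xs)
shift-increasing n m = AllPairs.map⁺ ∘ AllPairs.map (+-monoˡ-< (m * n))

shift-above : ∀ n m .{{_ : NonZero n}} {xs} → All (1 ≤_) xs → All (m <_) (shift n m xs)
shift-above n m = All.map⁺ ∘ All.map (λ 1≤x → +-mono-≤ 1≤x (m≤m*n m n))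

++-shift-increasing : ∀ n .{{_ : NonZero n}} t {rs xs} → Increasing rs → All (t <_) rs →
                      Increasing xs → All (1 ≤_) xs →
                      Increasing (rs ++ shift n (max t rs) xs) × All (t <_) (rs ++ shift n (max t rs) xs)
++-shift-increasing n t {rs} rs-inc t<rs xs-inc 1≤xs =
  AllPairs.++⁺ rs-inc (shift-increasing n m xs-inc)
    (All.map (λ r≤m → All.map (≤-<-trans r≤m) m<shifted) (xs≤max t rs)) ,
  All.++⁺ t<rs (All.map (≤-<-trans (⊥≤max t rs)) m<shifted)
  where
  m = max t rs
  m<shifted = shift-above n m 1≤xs

lab-periodic : ∀ {k} (a : Fin (suc k) → ℕ) m {x} → 1 ≤ x → lab a (x + m * suc k) ≡ lab a x
lab-periodic {k} a m {suc x} _ =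
  cong a (fromℕ<-cong _ _ ([m+kn]%n≡m%n x m (suc k)) _ _)

lab-shift : ∀ {k} (a : Fin (suc k) → ℕ) m {xs} → All (1 ≤_) xs → map (lab a) (shift (suc k) m xs) ≡ map (lab a) xs
lab-shift a m []            = refl
lab-shift a m (1≤x ∷ 1≤xs) = cong₂ _∷_ (lab-periodic a m 1≤x) (lab-shift a m 1≤xs)

module SortingWordOfIdeal
  (k : ℕ) (a : Fin (suc k) → ℕ) (a-range : ∀ i → 1 ≤ a i × a i ≤ suc k)
  (H : List ℕ) (H-sorts : IsSortPositions a (w0 (suc k)) H)
  (I : List ℕ) (I-linked : Linked _<_ I) (I⊆H : All (_∈ H) I)
  (I-ideal : ∀ x y → HeapLe a x y → y ∈ I → x ∈ H → x ∈ I) where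

  word : List ℕ → List ℕ
  word = map (lab a)

  W : List ℕ → ℕ → ℕ
  W = wordPerm ∘ word

  word-letters : ∀ ps → Letters (suc k) (word ps)
  word-letters = All.map⁺ ∘ All.universal (λ _ → a-range _)

  W-++ : ∀ ps qs → W (ps ++ qs) ≗ W ps ∘ W qs
  W-++ ps qs j = trans (cong (λ u → wordPerm u j) (map-++ (lab a) ps qs)) (wordPerm-++ (word ps) (word qs) j)

  shortest-length : ∀ ps qs → Shortest (suc k) (word ps) → W qs ≗ W ps → length ps ≤ length qs
  shortest-length ps qs shortest qs≗ps =
    subst₂ _≤_ (length-map (lab a) ps) (length-map (lab a) qs) (shortest (word qs) (word-letters qs) qs≗ps)

  H-positions : IsPositions H
  H-positions = proj₁ H-sorts

  H-reduced : IsReducedWord (suc k) (w0 (suc k)) (word H)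
  H-reduced = proj₁ (proj₂ H-sorts)

  H-inc : Increasing H
  H-inc = Linked⇒AllPairs <-trans (proj₁ H-positions)

  I-pos : All (1 ≤_) I
  I-pos = All.map (All.lookup (proj₂ H-positions)) I⊆H

  I-inc : Increasing I
  I-inc = Linked⇒AllPairs <-trans I-linked

  H-lexFirst : ∀ Q → IsPositions Q → W Q ≗ W H → length Q ≤ length H → LexLe H Q
  H-lexFirst Q Q-positions Q≗H |Q|≤|H| =
    proj₂ (proj₂ H-sorts) Q Q-positions (word-letters Q , Q≈w0 , Q-minimal)
    where
    Q≈w0 : W Q ≈[ suc k ] w0 (suc k)
    Q≈w0 j 1≤j j≤n = trans (Q≗H j) (proj₁ (proj₂ H-reduced) j 1≤j j≤n)
    Q-minimal : ∀ v → Letters (suc k) v → wordPerm v ≈[ suc k ] w0 (suc k) → length (word Q) ≤ length v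
    Q-minimal v lv v≈w0 = begin
      length (word Q) ≡⟨ length-map (lab a) Q ⟩
      length Q        ≤⟨ |Q|≤|H| ⟩
      length H        ≡⟨ length-map (lab a) H ⟨
      length (word H) ≤⟨ proj₂ (proj₂ H-reduced) v lv v≈w0 ⟩
      length v        ∎
      where open ≤-Reasoning

  H∖I-above : ℕ → List ℕ
  H∖I-above t = filter (∁? (_∈? I)) (above t H)

  ideal-commutes : ∀ {h y} → h ∈ H → h < y → ¬ h ∈ I → y ∈ I → ¬ Near (lab a h) (lab a y)
  ideal-commutes h∈H h<y h∉I y∈I (≤₁ , ≤₂) = h∉I (I-ideal _ _ (hstep h<y ≤₁ ≤₂ hrefl) y∈I h∈H)

  ideal-pairs-commute : ∀ {xs} → Increasing xs → All (_∈ H) xs →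
                        AllPairs (λ x y → ¬ x ∈ I → y ∈ I → ¬ Near (lab a x) (lab a y)) xs
  ideal-pairs-commute []           []             = []
  ideal-pairs-commute (x<xs ∷ inc) (x∈H ∷ xs⊆H) = All.map (ideal-commutes x∈H) x<xs ∷ ideal-pairs-commute inc xs⊆H

  above-H∩I : ∀ t → filter (_∈? I) (above t H) ≡ above t I
  above-H∩I t = increasing-⊆-antisym
    (AllPairs.filter⁺ (_∈? I) (above-increasing t H-inc)) (above-increasing t I-inc) sub sup
    where
    sub : filter (_∈? I) (above t H) ⊆ above t I
    sub z∈ = let z∈above , z∈I = ∈-filter⁻ (_∈? I) {xs = above t H} z∈
             in ∈-filter⁺ (t <?_) z∈I (proj₂ (∈-filter⁻ (t <?_) {xs = H} z∈above))
    sup : above t I ⊆ filter (_∈? I) (above t H)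
    sup z∈ = let z∈I , t<z = ∈-filter⁻ (t <?_) z∈
             in ∈-filter⁺ (_∈? I) (∈-filter⁺ (t <?_) (All.lookup I⊆H z∈I) t<z) z∈I

  W-above-H : ∀ t → W (above t H) ≗ W (above t I) ∘ W (H∖I-above t)
  W-above-H t j = trans
    (wordPerm-partition (_∈? I) (lab a) (above t H)
      (ideal-pairs-commute (above-increasing t H-inc) (All.tabulate (proj₁ ∘ ∈-filter⁻ (t <?_)))) j)
    (cong (λ ps → W ps (W (H∖I-above t) j)) (above-H∩I t))

  length-above-H : ∀ t → length (above t I) + length (H∖I-above t) ≡ length (above t H)
  length-above-H t = trans (cong (λ ps → length ps + length (H∖I-above t)) (sym (above-H∩I t)))
                           (length-partition (_∈? I) (above t H))

  H-split : ∀ t → atMost t H ++ above t H ≡ H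
  H-split t = atMost++above t H-inc

  length-H : ∀ t → length (atMost t H) + (length (above t I) + length (H∖I-above t)) ≡ length H
  length-H t = begin
    length (atMost t H) + (length (above t I) + length (H∖I-above t)) ≡⟨ cong (length (atMost t H) +_) (length-above-H t) ⟩
    length (atMost t H) + length (above t H)                          ≡⟨ length-++ (atMost t H) ⟨
    length (atMost t H ++ above t H)                                  ≡⟨ cong length (H-split t) ⟩
    length H                                                          ∎
    where open ≡-Reasoning

  above-shortest : ∀ t → Shortest (suc k) (word (above t H))
  above-shortest t = shortest-++⁻ʳ (word (above t H)) (word-letters (atMost t H))
    (subst (Shortest (suc k)) word-H (reduced⇒shortest H-reduced))
    where
    word-H : word H ≡ word (atMost t H) ++ word (above t H)
    word-H = trans (cong word (sym (H-split t))) (map-++ (lab a) (atMost t H) (above t H))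

  shortest-prefix : ∀ ps qs rs → W ps ≗ W (qs ++ rs) → length ps ≡ length (qs ++ rs) →
                    Shortest (suc k) (word ps) → Shortest (suc k) (word qs)
  shortest-prefix ps qs rs ps≗ |ps|≡ shortest =
    shortest-++⁻ˡ (word qs) (word-letters rs) (subst (Shortest (suc k)) (map-++ (lab a) qs rs)
      (shortest-resp {u = word ps} {u′ = word (qs ++ rs)} ps≗ |word-ps|≡ shortest))
    where
    |word-ps|≡ : length (word ps) ≡ length (word (qs ++ rs))
    |word-ps|≡ = trans (length-map (lab a) ps) (trans |ps|≡ (sym (length-map (lab a) (qs ++ rs))))

  above-I-shortest : ∀ t → Shortest (suc k) (word (above t I))
  above-I-shortest t = shortest-prefix (above t H) (above t I) (H∖I-above t)
    (λ j → trans (W-above-H t j) (sym (W-++ (above t I) (H∖I-above t) j)))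
    (trans (sym (length-above-H t)) (sym (length-++ (above t I))))
    (above-shortest t)

  ∷-above-I-shortest : ∀ {y} → y ∈ H → Shortest (suc k) (word (y ∷ above y I))
  ∷-above-I-shortest {zero}  0∈H = contradiction (All.lookup (proj₂ H-positions) 0∈H) λ ()
  ∷-above-I-shortest {suc t} y∈H =
    shortest-prefix (suc t ∷ above (suc t) H) (suc t ∷ above (suc t) I) (H∖I-above (suc t))
    (λ j → cong (s (lab a (suc t))) (trans (W-above-H (suc t) j) (sym (W-++ (above (suc t) I) (H∖I-above (suc t)) j))))
    (cong suc (trans (sym (length-above-H (suc t))) (sym (length-++ (above (suc t) I)))))
    (subst (Shortest (suc k) ∘ word) (above-suc t H-inc y∈H) (above-shortest t))

  H-start-longer : ∀ {y qs} → y ∈ H → W (y ∷ qs) ≗ W (above y I) → length (above y I) < length qs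
  H-start-longer {y} {qs} y∈H y∷qs≗I = shortest-length (y ∷ above y I) qs (∷-above-I-shortest y∈H) qs≗y∷I
    where
    qs≗y∷I : W qs ≗ W (y ∷ above y I)
    qs≗y∷I j = trans (sym (s-involutive (lab a y) (W qs j))) (cong (s (lab a y)) (y∷qs≗I j))

  replace-above-I : ∀ t u → wordPerm u ≗ W (above t I) → wordPerm (word (atMost t H) ++ u ++ word (H∖I-above t)) ≗ W H
  replace-above-I t u u≗I j = begin
    wordPerm (word P ++ u ++ word R) j ≡⟨ wordPerm-++ (word P) (u ++ word R) j ⟩
    W P (wordPerm (u ++ word R) j)     ≡⟨ cong (W P) (wordPerm-++ u (word R) j) ⟩
    W P (wordPerm u (W R j))           ≡⟨ cong (W P) (u≗I (W R j)) ⟩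
    W P (W (above t I) (W R j))        ≡⟨ cong (W P) (W-above-H t j) ⟨
    W P (W (above t H) j)              ≡⟨ W-++ P (above t H) j ⟨
    W (P ++ above t H) j               ≡⟨ cong (λ ps → W ps j) (H-split t) ⟩
    W H j                              ∎
    where
    open ≡-Reasoning
    P = atMost t H
    R = H∖I-above t

  above-H-lexFirst : ∀ t rs → Increasing rs → All (t <_) rs → W rs ≗ W (above t I) →
                     length rs ≤ length (above t I) →
                     LexLe (above t H) (rs ++ shift (suc k) (max t rs) (H∖I-above t))
  above-H-lexFirst t rs rs-inc t<rs rs≗I |rs|≤|I| =
    LexLe-++⁻ P (subst (λ xs → LexLe xs Q) (sym (H-split t)) (H-lexFirst Q Q-positions Q≗H |Q|≤|H|))
    where
    P = atMost t H
    R = H∖I-above t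
    R-pos : All (1 ≤_) R
    R-pos = All.filter⁺ _ (All.filter⁺ (t <?_) (proj₂ H-positions))
    shifted = shift (suc k) (max t rs) R
    tail = rs ++ shifted
    Q = P ++ tail
    tail-inc×t<tail = ++-shift-increasing (suc k) t rs-inc t<rs (AllPairs.filter⁺ _ (above-increasing t H-inc)) R-pos
    Q-positions : IsPositions Q
    Q-positions =
      AllPairs⇒Linked (AllPairs.++⁺ (AllPairs.filter⁺ (_≤? t) H-inc) (proj₁ tail-inc×t<tail)
        (All.tabulate λ p∈P → All.map (≤-<-trans (proj₂ (∈-filter⁻ (_≤? t) {xs = H} p∈P))) (proj₂ tail-inc×t<tail))) ,
      All.++⁺ (All.filter⁺ (_≤? t) (proj₂ H-positions)) (All.map (≤-trans (s≤s z≤n)) (proj₂ tail-inc×t<tail))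
    word-Q : word Q ≡ word P ++ word rs ++ word R
    word-Q = trans (map-++ (lab a) P tail)
      (cong (word P ++_) (trans (map-++ (lab a) rs shifted) (cong (word rs ++_) (lab-shift a (max t rs) R-pos))))
    Q≗H : W Q ≗ W H
    Q≗H j = trans (cong (λ u → wordPerm u j) word-Q) (replace-above-I t (word rs) rs≗I j)
    |Q|≤|H| : length Q ≤ length H
    |Q|≤|H| = begin
      length Q                                   ≡⟨ length-++ P ⟩
      length P + length tail                     ≡⟨ cong (length P +_) (length-++ rs) ⟩
      length P + (length rs + length shifted)    ≡⟨ cong (λ l → length P + (length rs + l)) (length-map _ R) ⟩
      length P + (length rs + length R)          ≤⟨ +-monoʳ-≤ (length P) (+-monoˡ-≤ (length R) |rs|≤|I|) ⟩
      length P + (length (above t I) + length R) ≡⟨ length-H t ⟩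
      length H                                   ∎
      where open ≤-Reasoning

  nonH-start-impossible : ∀ {t qs} → ¬ suc t ∈ H → Increasing (suc t ∷ qs) → W (suc t ∷ qs) ≗ W (above t I) →
                          length (suc t ∷ qs) ≤ length (above t I) → ⊥
  nonH-start-impossible {t} {qs} t+1∉H inc eq len = first-above (above t H) refl
    (above-H-lexFirst t (suc t ∷ qs) inc (n<1+n t ∷ All.map (<-trans (n<1+n t)) (AllPairs.head inc)) eq len)
    (≤-trans (s≤s z≤n) (≤-trans len (≤-trans (m≤m+n _ _) (≤-reflexive (length-above-H t)))))
    where
    first-above : ∀ xs → above t H ≡ xs → ∀ {rest} → LexLe xs (suc t ∷ rest) → 0 < length xs → ⊥
    first-above []      _      _  ()
    first-above (h ∷ _) above≡ le _ = LexLe⇒≯ le (here t+1<h)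
      where
      h∈H×t<h = ∈-filter⁻ (t <?_) {xs = H} (subst (h ∈_) (sym above≡) (here refl))
      t+1<h = ≤∧≢⇒< (proj₂ h∈H×t<h) (λ t+1≡h → t+1∉H (subst (_∈ H) (sym t+1≡h) (proj₁ h∈H×t<h)))

  above-I-skip : ∀ {t u x js} → t ≤ u → u < x → above t I ≡ x ∷ js → above u I ≡ x ∷ js
  above-I-skip {t} {u} {x} {js} t≤u u<x above≡ = begin
    above u I           ≡⟨ above-above t≤u I ⟨
    above u (above t I) ≡⟨ cong (above u) above≡ ⟩
    above u (x ∷ js)    ≡⟨ filter-all (u <?_) (u<x ∷ All.map (<-trans u<x) x<js) ⟩
    x ∷ js              ∎
    where
    open ≡-Reasoning
    x<js = AllPairs.head (subst Increasing above≡ (above-increasing t I-inc))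

  above-I-head : ∀ {t x js} → above t I ≡ x ∷ js → above x I ≡ js
  above-I-head {t} {x} {js} above≡ = begin
    above x I           ≡⟨ above-above (<⇒≤ t<x) I ⟨
    above x (above t I) ≡⟨ cong (above x) above≡ ⟩
    above x (x ∷ js)    ≡⟨ filter-reject (x <?_) (<-irrefl refl) ⟩
    above x js          ≡⟨ filter-all (x <?_) (AllPairs.head (subst Increasing above≡ (above-increasing t I-inc))) ⟩
    js                  ∎
    where
    open ≡-Reasoning
    t<x = proj₂ (∈-filter⁻ (t <?_) {xs = I} (subst (x ∈_) (sym above≡) (here refl)))

  earlier-start-impossible : ∀ {t x js y qs} → above t I ≡ x ∷ js → t < y → y < x → Increasing (y ∷ qs) →
                             W (y ∷ qs) ≗ W (x ∷ js) → length (y ∷ qs) ≤ length (x ∷ js) → ⊥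
  earlier-start-impossible {y = zero} _ () _ _ _ _
  earlier-start-impossible {t} {x} {js} {suc u} {qs} above≡ t<y y<x inc eq len = start (suc u ∈? H)
    where
    above-I-at : ∀ {v} → t ≤ v → v < x →
                 W (suc u ∷ qs) ≗ W (above v I) × length (suc u ∷ qs) ≤ length (above v I)
    above-I-at t≤v v<x rewrite above-I-skip t≤v v<x above≡ = eq , len
    start : Dec (suc u ∈ H) → ⊥
    start (yes y∈H) = let eq′ , len′ = above-I-at (<⇒≤ t<y) y<x
                      in <-asym (H-start-longer {qs = qs} y∈H eq′) len′
    start (no y∉H)  = let eq′ , len′ = above-I-at (s≤s⁻¹ t<y) (<-trans (n<1+n u) y<x)
                      in nonH-start-impossible y∉H inc eq′ len′

  above-I-lexFirst : ∀ {t js} qs → above t I ≡ js → Increasing qs → All (t <_) qs → W qs ≗ W js →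
                     length qs ≤ length js → LexLe js qs
  above-I-lexFirst {js = []}     []       _  _ _ _ _ = inj₁ refl
  above-I-lexFirst {t} {x ∷ js}  []       above≡ _ _ eq _ =
    contradiction (shortest-length (x ∷ js) [] (subst (Shortest (suc k) ∘ word) above≡ (above-I-shortest t)) eq)
                  λ ()
  above-I-lexFirst {js = []}     (_ ∷ _)  _  _ _ _ ()
  above-I-lexFirst {t} {x ∷ js}  (y ∷ qs) above≡ (y<qs ∷ inc) (t<y ∷ _) eq len with <-cmp y x
  ... | tri< y<x _ _ = ⊥-elim (earlier-start-impossible above≡ t<y y<x (y<qs ∷ inc) eq len)
  ... | tri> _ _ x<y = inj₂ (here x<y)
  ... | tri≈ _ refl _ =
    LexLe-∷ (above-I-lexFirst qs (above-I-head above≡) inc y<qs (λ j → s-injective (lab a y) (eq j)) (s≤s⁻¹ len))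

  above-0-I : above 0 I ≡ I
  above-0-I = filter-all (0 <?_) I-pos

  I-sorts : IsSortPositions a (W I) I
  I-sorts = (I-linked , I-pos) , shortest⇒reduced (word-letters I) I-shortest , I-lexFirst
    where
    I-shortest : Shortest (suc k) (word I)
    I-shortest = subst (Shortest (suc k) ∘ word) above-0-I (above-I-shortest 0)
    I-lexFirst : ∀ qs → IsPositions qs → IsReducedWord (suc k) (W I) (word qs) → LexLe I qs
    I-lexFirst qs (qs-linked , qs-pos) qs-reduced@(qs-letters , qs≈I , _) =
      above-I-lexFirst qs above-0-I (Linked⇒AllPairs <-trans qs-linked) qs-pos qs≗I
        (shortest-length qs I (reduced⇒shortest qs-reduced) (λ j → sym (qs≗I j)))
      where
      qs≗I : W qs ≗ W I
      qs≗I = ≈⇒≗ qs-letters (word-letters I) qs≈I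

proposition2p18 : (k : ℕ) (a : Fin (suc k) → ℕ) →
    (∀ i j → a i ≡ a j → i ≡ j) →
    (∀ i → 1 ≤ a i × a i ≤ suc k) →
    (H : List ℕ) → IsSortPositions a (w0 (suc k)) H →
    (I : List ℕ) → Linked _<_ I → All (_∈ H) I →
    (∀ x y → HeapLe a x y → y ∈ I → x ∈ H → x ∈ I) →
    ∃ λ ps → IsSortPositions a (wordPerm (map (lab a) I)) ps × map (lab a) ps ≡ map (lab a) I
proposition2p18 k a _ a-range H H-sorts I I-linked I⊆H I-ideal =
  I , SortingWordOfIdeal.I-sorts k a a-range H H-sorts I I-linked I⊆H I-ideal , refl
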